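{- Let $v\in\mathbb Q$, $v\neq0$, and let $c=\dfrac{v^4+16}{8v}$. Then the polynomial $P_c=x^6-4x^2-c^2\in\mathbb Q[x]$ satisfies \[64v^2\cdot P_c=(8vx^3-8v^2x^2+4v^3x-v^4-16)(8vx^3+8v^2x^2+4v^3x+v^4+16),\] and both cubic factors on the right are irreducible over $\mathbb Q$. -}

module Defs where

open import Data.Nat using (ℕ; zero; suc)
open import Data.Integer using (+_)
open import Data.Rational using (ℚ; 0ℚ; _+_; _*_; -_; _/_; 1/_; ≢-nonZero)
open import Data.List using (List; []; _∷_; map)
open import Data.Product using (Σ; _×_)
open import Data.Sum using (_⊎_)
open import Relation.Nullary using (¬_)
open import Relation.Binary.PropositionalEquality using (_≡_; _≢_)

-- Polynomials over ℚ as coefficient lists, constant coefficient first.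
-- Trailing zeros are allowed; equality of polynomials is coefficientwise (_≈ₚ_).
Poly : Set
Poly = List ℚ

coeff : Poly → ℕ → ℚ
coeff []       _       = 0ℚ
coeff (a ∷ p)  zero    = a
coeff (a ∷ p)  (suc n) = coeff p n

infixl 6 _+ₚ_
infixl 7 _*ₚ_
infix 4 _≈ₚ_

_+ₚ_ : Poly → Poly → Poly
[]      +ₚ q       = q
(a ∷ p) +ₚ []      = a ∷ p
(a ∷ p) +ₚ (b ∷ q) = (a + b) ∷ (p +ₚ q)

_*ₚ_ : Poly → Poly → Poly
[]      *ₚ q = []
(a ∷ p) *ₚ q = map (a *_) q +ₚ (0ℚ ∷ (p *ₚ q))

_≈ₚ_ : Poly → Poly → Set
p ≈ₚ q = ∀ n → coeff p n ≡ coeff q n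

IsUnit : Poly → Set
IsUnit p = Σ ℚ (λ a → (a ≢ 0ℚ) × (p ≈ₚ (a ∷ [])))

Irreducible : Poly → Set
Irreducible p = (¬ (p ≈ₚ [])) × (¬ IsUnit p) × (∀ g h → p ≈ₚ g *ₚ h → IsUnit g ⊎ IsUnit h)

ℚ[_] : ℕ → ℚ
ℚ[ n ] = + n / 1

cOf : (v : ℚ) → v ≢ 0ℚ → ℚ
cOf v v≢0 = (v * v * v * v + ℚ[ 16 ]) * (1/_ v {{≢-nonZero v≢0}}) * (+ 1 / 8)

P : ℚ → Poly
P c = (- (c * c)) ∷ 0ℚ ∷ (- ℚ[ 4 ]) ∷ 0ℚ ∷ 0ℚ ∷ 0ℚ ∷ ℚ[ 1 ] ∷ []

F₁ : ℚ → Poly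
F₁ v = (- (v * v * v * v) + - ℚ[ 16 ]) ∷ (ℚ[ 4 ] * v * v * v) ∷ (- (ℚ[ 8 ] * v * v)) ∷ (ℚ[ 8 ] * v) ∷ []

F₂ : ℚ → Poly
F₂ v = (v * v * v * v + ℚ[ 16 ]) ∷ (ℚ[ 4 ] * v * v * v) ∷ (ℚ[ 8 ] * v * v) ∷ (ℚ[ 8 ] * v) ∷ []

module Submission where

-- A cubic over ℚ without a rational root is irreducible: in any factorisation
-- one factor has degree at most one.  If F₁(r) = 0, then t = 2r/v − 1 and
-- u = 2/v ≠ 0 satisfy t³ + t² + t = u⁴, and F₂(r) = −F₁(−r).  Writing t = a/b
-- and u = p/q in lowest terms gives a(a² + ab + b²)q⁴ = p⁴b³.  For a < 0 the
-- two sides have opposite signs.  For a ≥ 0 coprimality makes a, a² + ab + b²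
-- and b fourth powers r⁴, s⁴ and m⁴, so s⁴ + (rm)⁴ = (a + b)², which Fermat's
-- descent through Euclid's parametrisation of Pythagorean triples rules out.
-- In the factorisation only the constant coefficient uses 8vc = v⁴ + 16.

open import Defs

module Polynomials where

  open import Data.Nat.Base as ℕ using (ℕ; zero; suc; z≤n; s≤s)
  import Data.Nat.Properties as ℕ
  open import Data.Rational.Base using (ℚ; 0ℚ; 1ℚ; _+_; _*_; -_; 1/_; ≢-nonZero)
  open import Data.Rational.Properties
    using ( +-*-commutativeRing; _≟_; +-identityˡ; +-identityʳ
          ; *-zeroˡ; *-zeroʳ; *-identityˡ; *-assoc; *-inverseˡ)
  open import Data.List.Base using ([]; _∷_; map; length)
  open import Data.Product.Base using (∃-syntax; _,_; proj₂)
  open import Data.Sum.Base using (_⊎_; inj₁; inj₂; [_,_]′)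
  open import Level using (0ℓ)
  open import Relation.Binary.Definitions using (tri<; tri≈; tri>)
  open import Relation.Binary.PropositionalEquality
  open import Relation.Nullary.Decidable using (yes; no; dec⇒maybe)
  open import Relation.Nullary.Negation using (¬_; contradiction)
  open import Tactic.RingSolver using (solve)
  open import Tactic.RingSolver.Core.AlmostCommutativeRing
    using (AlmostCommutativeRing; fromCommutativeRing)

  ℚ-ring : AlmostCommutativeRing 0ℓ 0ℓ
  ℚ-ring = fromCommutativeRing +-*-commutativeRing (λ x → dec⇒maybe (0ℚ ≟ x))

  x*y≡0⇒x≡0∨y≡0 : ∀ x y → x * y ≡ 0ℚ → x ≡ 0ℚ ⊎ y ≡ 0ℚ
  x*y≡0⇒x≡0∨y≡0 x y xy≡0 with x ≟ 0ℚ
  ... | yes x≡0 = inj₁ x≡0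
  ... | no  x≢0 = inj₂ (begin
    y               ≡⟨ *-identityˡ y ⟨
    1ℚ * y          ≡⟨ cong (_* y) (*-inverseˡ x) ⟨
    1/ x * x * y    ≡⟨ *-assoc (1/ x) x y ⟩
    1/ x * (x * y)  ≡⟨ cong (1/ x *_) xy≡0 ⟩
    1/ x * 0ℚ       ≡⟨ *-zeroʳ (1/ x) ⟩
    0ℚ              ∎)
    where
    open ≡-Reasoning
    instance _ = ≢-nonZero x≢0

  x*y≡0⇒y≡0 : ∀ {x y} → x ≢ 0ℚ → x * y ≡ 0ℚ → y ≡ 0ℚ
  x*y≡0⇒y≡0 {x} {y} x≢0 xy≡0 =
    [ (λ x≡0 → contradiction x≡0 x≢0) , (λ y≡0 → y≡0) ]′ (x*y≡0⇒x≡0∨y≡0 x y xy≡0)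

  x*y≢0 : ∀ {x y} → x ≢ 0ℚ → y ≢ 0ℚ → x * y ≢ 0ℚ
  x*y≢0 {x} {y} x≢0 y≢0 xy≡0 = [ x≢0 , y≢0 ]′ (x*y≡0⇒x≡0∨y≡0 x y xy≡0)

  coeff-+ₚ : ∀ p q n → coeff (p +ₚ q) n ≡ coeff p n + coeff q n
  coeff-+ₚ []      q       n       = sym (+-identityˡ (coeff q n))
  coeff-+ₚ (a ∷ p) []      n       = sym (+-identityʳ (coeff (a ∷ p) n))
  coeff-+ₚ (a ∷ p) (b ∷ q) zero    = refl
  coeff-+ₚ (a ∷ p) (b ∷ q) (suc n) = coeff-+ₚ p q n

  coeff-map : ∀ a q n → coeff (map (a *_) q) n ≡ a * coeff q n
  coeff-map a []      n       = sym (*-zeroʳ a)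
  coeff-map a (b ∷ q) zero    = refl
  coeff-map a (b ∷ q) (suc n) = coeff-map a q n

  coeff-∷-*ₚ : ∀ a p q n → coeff ((a ∷ p) *ₚ q) n ≡ a * coeff q n + coeff (0ℚ ∷ p *ₚ q) n
  coeff-∷-*ₚ a p q n =
    trans (coeff-+ₚ (map (a *_) q) (0ℚ ∷ p *ₚ q) n) (cong (_+ _) (coeff-map a q n))

  coeff-≥length : ∀ p {n} → length p ℕ.≤ n → coeff p n ≡ 0ℚ
  coeff-≥length []      _           = refl
  coeff-≥length (a ∷ p) (s≤s len≤n) = coeff-≥length p len≤n

  ∷-≈ₚ[] : ∀ {a p} → a ≡ 0ℚ → p ≈ₚ [] → a ∷ p ≈ₚ []
  ∷-≈ₚ[] a≡0 p≈0 zero    = a≡0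
  ∷-≈ₚ[] a≡0 p≈0 (suc n) = p≈0 n

  *ₚ-zeroˡ : ∀ p q → p ≈ₚ [] → p *ₚ q ≈ₚ []
  *ₚ-zeroˡ []      q p≈0 n = refl
  *ₚ-zeroˡ (a ∷ p) q p≈0 n = begin
    coeff ((a ∷ p) *ₚ q) n                 ≡⟨ coeff-∷-*ₚ a p q n ⟩
    a * coeff q n + coeff (0ℚ ∷ p *ₚ q) n  ≡⟨ cong₂ _+_ (cong (_* coeff q n) (p≈0 0)) (0∷pq≈0 n) ⟩
    0ℚ * coeff q n + 0ℚ                    ≡⟨ cong (_+ 0ℚ) (*-zeroˡ (coeff q n)) ⟩
    0ℚ                                     ∎
    where
    open ≡-Reasoning
    0∷pq≈0 = ∷-≈ₚ[] refl (*ₚ-zeroˡ p q (λ n → p≈0 (suc n)))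

  record HasDegree (p : Poly) (d : ℕ) : Set where
    constructor has-degree
    field
      leading≢0 : coeff p d ≢ 0ℚ
      vanishes  : ∀ n → d ℕ.< n → coeff p n ≡ 0ℚ

  ≈ₚ[]⊎hasDegree : ∀ p → p ≈ₚ [] ⊎ ∃[ d ] HasDegree p d
  ≈ₚ[]⊎hasDegree []      = inj₁ λ _ → refl
  ≈ₚ[]⊎hasDegree (a ∷ p) with ≈ₚ[]⊎hasDegree p
  ... | inj₂ (d , has-degree lead≢0 vanish) =
    inj₂ (suc d , has-degree lead≢0 λ { (suc n) (s≤s d<n) → vanish n d<n })
  ... | inj₁ p≈0 with a ≟ 0ℚ
  ...   | yes a≡0 = inj₁ (∷-≈ₚ[] a≡0 p≈0)
  ...   | no  a≢0 = inj₂ (0 , has-degree a≢0 λ { (suc n) _ → p≈0 n })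

  hasDegree-unique : ∀ {p d e} → HasDegree p d → HasDegree p e → d ≡ e
  hasDegree-unique {d = d} {e} (has-degree lead-d≢0 vanish-d) (has-degree lead-e≢0 vanish-e)
    with ℕ.<-cmp d e
  ... | tri< d<e _ _ = contradiction (vanish-d e d<e) lead-e≢0
  ... | tri≈ _ d≡e _ = d≡e
  ... | tri> _ _ e<d = contradiction (vanish-e d e<d) lead-d≢0

  hasDegree-resp-≈ₚ : ∀ {p q d} → p ≈ₚ q → HasDegree p d → HasDegree q d
  hasDegree-resp-≈ₚ {d = d} p≈q (has-degree lead≢0 vanish) = has-degree
    (λ lead≡0 → lead≢0 (trans (p≈q d) lead≡0))
    (λ n d<n → trans (sym (p≈q n)) (vanish n d<n))

  hasDegree-cubic : ∀ {a b c d} → d ≢ 0ℚ → HasDegree (a ∷ b ∷ c ∷ d ∷ []) 3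
  hasDegree-cubic d≢0 = has-degree d≢0 λ n 3<n → coeff-≥length (_ ∷ _ ∷ _ ∷ _ ∷ []) 3<n

  hasDegree-*ₚ : ∀ {g h i j} → HasDegree g i → HasDegree h j → HasDegree (g *ₚ h) (i ℕ.+ j)
  hasDegree-*ₚ {[]} (has-degree lead≢0 _) _ = contradiction refl lead≢0
  hasDegree-*ₚ {a ∷ p} {h} {zero} {j} (has-degree a≢0 vanish) (has-degree lead≢0 vanish-h) =
    has-degree
      (λ lead≡0 → x*y≢0 a≢0 lead≢0 (trans (sym (coeff≡a*coeff j)) lead≡0))
      (λ n j<n → trans (coeff≡a*coeff n) (trans (cong (a *_) (vanish-h n j<n)) (*-zeroʳ a)))
    where
    0∷ph≈0 = ∷-≈ₚ[] refl (*ₚ-zeroˡ p h (λ n → vanish (suc n) (s≤s z≤n)))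
    coeff≡a*coeff : ∀ n → coeff ((a ∷ p) *ₚ h) n ≡ a * coeff h n
    coeff≡a*coeff n =
      trans (coeff-∷-*ₚ a p h n) (trans (cong (a * coeff h n +_) (0∷ph≈0 n)) (+-identityʳ _))
  hasDegree-*ₚ {a ∷ p} {h} {suc i} {j} (has-degree lead≢0 vanish) deg-h@(has-degree _ vanish-h) =
    has-degree
      (λ lead≡0 → HasDegree.leading≢0 deg-ph (trans (sym (shift (i ℕ.+ j) ℕ.≤-refl)) lead≡0))
      (λ { (suc n) (s≤s i+j<n) → trans (shift n (ℕ.<⇒≤ i+j<n)) (HasDegree.vanishes deg-ph n i+j<n) })
    where
    deg-ph = hasDegree-*ₚ {p} {h} (has-degree lead≢0 λ n i<n → vanish (suc n) (s≤s i<n)) deg-h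
    shift : ∀ n → i ℕ.+ j ℕ.≤ n → coeff ((a ∷ p) *ₚ h) (suc n) ≡ coeff (p *ₚ h) n
    shift n i+j≤n = begin
      coeff ((a ∷ p) *ₚ h) (suc n)            ≡⟨ coeff-∷-*ₚ a p h (suc n) ⟩
      a * coeff h (suc n) + coeff (p *ₚ h) n  ≡⟨ cong (λ c → a * c + coeff (p *ₚ h) n) h-vanishes ⟩
      a * 0ℚ + coeff (p *ₚ h) n               ≡⟨ cong (_+ coeff (p *ₚ h) n) (*-zeroʳ a) ⟩
      0ℚ + coeff (p *ₚ h) n                   ≡⟨ +-identityˡ (coeff (p *ₚ h) n) ⟩
      coeff (p *ₚ h) n                        ∎
      where
      open ≡-Reasoning
      h-vanishes = vanish-h (suc n) (s≤s (ℕ.≤-trans (ℕ.m≤n+m j i) i+j≤n))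

  eval : Poly → ℚ → ℚ
  eval []      x = 0ℚ
  eval (a ∷ p) x = a + x * eval p x

  eval-+ₚ : ∀ p q x → eval (p +ₚ q) x ≡ eval p x + eval q x
  eval-+ₚ []      q       x = sym (+-identityˡ (eval q x))
  eval-+ₚ (a ∷ p) []      x = sym (+-identityʳ (eval (a ∷ p) x))
  eval-+ₚ (a ∷ p) (b ∷ q) x =
    trans (cong (λ e → a + b + x * e) (eval-+ₚ p q x)) (regroup a b x (eval p x) (eval q x))
    where
    regroup : ∀ a b x P Q → a + b + x * (P + Q) ≡ a + x * P + (b + x * Q)
    regroup a b x P Q = solve (a ∷ b ∷ x ∷ P ∷ Q ∷ []) ℚ-ring

  eval-map : ∀ a q x → eval (map (a *_) q) x ≡ a * eval q x
  eval-map a []      x = sym (*-zeroʳ a)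
  eval-map a (b ∷ q) x =
    trans (cong (λ e → a * b + x * e) (eval-map a q x)) (factor-out a b x (eval q x))
    where
    factor-out : ∀ a b x Q → a * b + x * (a * Q) ≡ a * (b + x * Q)
    factor-out a b x Q = solve (a ∷ b ∷ x ∷ Q ∷ []) ℚ-ring

  eval-*ₚ : ∀ p q x → eval (p *ₚ q) x ≡ eval p x * eval q x
  eval-*ₚ []      q x = sym (*-zeroˡ (eval q x))
  eval-*ₚ (a ∷ p) q x = begin
    eval (map (a *_) q +ₚ (0ℚ ∷ p *ₚ q)) x
      ≡⟨ eval-+ₚ (map (a *_) q) (0ℚ ∷ p *ₚ q) x ⟩
    eval (map (a *_) q) x + (0ℚ + x * eval (p *ₚ q) x)
      ≡⟨ cong₂ (λ e f → e + (0ℚ + x * f)) (eval-map a q x) (eval-*ₚ p q x) ⟩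
    a * eval q x + (0ℚ + x * (eval p x * eval q x))
      ≡⟨ factor-out a x (eval p x) (eval q x) ⟩
    (a + x * eval p x) * eval q x
      ∎
    where
    open ≡-Reasoning
    factor-out : ∀ a x P Q → a * Q + (0ℚ + x * (P * Q)) ≡ (a + x * P) * Q
    factor-out a x P Q = solve (a ∷ x ∷ P ∷ Q ∷ []) ℚ-ring

  eval-≈ₚ[] : ∀ p x → p ≈ₚ [] → eval p x ≡ 0ℚ
  eval-≈ₚ[] []      x p≈0 = refl
  eval-≈ₚ[] (a ∷ p) x p≈0 = begin
    a + x * eval p x  ≡⟨ cong₂ (λ a e → a + x * e) (p≈0 0) (eval-≈ₚ[] p x (λ n → p≈0 (suc n))) ⟩
    0ℚ + x * 0ℚ       ≡⟨ cong (0ℚ +_) (*-zeroʳ x) ⟩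
    0ℚ                ∎
    where open ≡-Reasoning

  eval-resp-≈ₚ : ∀ p q x → p ≈ₚ q → eval p x ≡ eval q x
  eval-resp-≈ₚ []      q       x p≈q = sym (eval-≈ₚ[] q x (λ n → sym (p≈q n)))
  eval-resp-≈ₚ (a ∷ p) []      x p≈q = eval-≈ₚ[] (a ∷ p) x p≈q
  eval-resp-≈ₚ (a ∷ p) (b ∷ q) x p≈q =
    cong₂ (λ a e → a + x * e) (p≈q 0) (eval-resp-≈ₚ p q x (λ n → p≈q (suc n)))

  root-of-*ₚ : ∀ g h r → eval g r ≡ 0ℚ ⊎ eval h r ≡ 0ℚ → eval (g *ₚ h) r ≡ 0ℚ
  root-of-*ₚ g h r (inj₁ g[r]≡0) =
    trans (eval-*ₚ g h r) (trans (cong (_* eval h r) g[r]≡0) (*-zeroˡ (eval h r)))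
  root-of-*ₚ g h r (inj₂ h[r]≡0) =
    trans (eval-*ₚ g h r) (trans (cong (eval g r *_) h[r]≡0) (*-zeroʳ (eval g r)))

  hasDegree-0⇒isUnit : ∀ {g} → HasDegree g 0 → IsUnit g
  hasDegree-0⇒isUnit {g} (has-degree lead≢0 vanish) =
    coeff g 0 , lead≢0 , λ { zero → refl ; (suc n) → vanish (suc n) (s≤s z≤n) }

  hasDegree-1⇒root : ∀ {g} → HasDegree g 1 → ∃[ r ] eval g r ≡ 0ℚ
  hasDegree-1⇒root {g} (has-degree lead≢0 vanish) = r , (begin
    eval g r                    ≡⟨ eval-resp-≈ₚ g (g₀ ∷ g₁ ∷ []) r g≈g₀+g₁x ⟩
    g₀ + r * (g₁ + r * 0ℚ)      ≡⟨ expand g₀ g₁ (1/ g₁) ⟩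
    g₀ * (1ℚ + - (1/ g₁ * g₁))  ≡⟨ cong (λ e → g₀ * (1ℚ + - e)) (*-inverseˡ g₁) ⟩
    g₀ * 0ℚ                     ≡⟨ *-zeroʳ g₀ ⟩
    0ℚ                          ∎)
    where
    open ≡-Reasoning
    g₀ = coeff g 0
    g₁ = coeff g 1
    instance _ = ≢-nonZero lead≢0
    r = - (g₀ * 1/ g₁)
    g≈g₀+g₁x : g ≈ₚ g₀ ∷ g₁ ∷ []
    g≈g₀+g₁x zero          = refl
    g≈g₀+g₁x (suc zero)    = refl
    g≈g₀+g₁x (suc (suc n)) = vanish (suc (suc n)) (s≤s (s≤s z≤n))
    expand : ∀ a b w → a + - (a * w) * (b + - (a * w) * 0ℚ) ≡ a * (1ℚ + - (w * b))
    expand a b w = solve (a ∷ b ∷ w ∷ []) ℚ-ring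

  degree-≤1-factor : ∀ {g h i j} → i ℕ.+ j ≡ 3 → HasDegree g i → HasDegree h j →
                     HasDegree g 0 ⊎ HasDegree g 1 ⊎ HasDegree h 0 ⊎ HasDegree h 1
  degree-≤1-factor {i = 0}                             _ deg-g _     = inj₁ deg-g
  degree-≤1-factor {i = 1}                             _ deg-g _     = inj₂ (inj₁ deg-g)
  degree-≤1-factor {i = suc (suc i)} {j = 0}           _ _     deg-h = inj₂ (inj₂ (inj₁ deg-h))
  degree-≤1-factor {i = suc (suc i)} {j = 1}           _ _     deg-h = inj₂ (inj₂ (inj₂ deg-h))
  degree-≤1-factor {i = suc (suc i)} {j = suc (suc j)} i+j≡3 _ _ = contradiction
    (ℕ.suc-injective (trans (sym (ℕ.+-suc i (suc j))) (ℕ.suc-injective (ℕ.suc-injective i+j≡3))))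
    (ℕ.m+1+n≢0 i)

  cubic-irreducible : ∀ {F} → HasDegree F 3 → (∀ r → eval F r ≢ 0ℚ) → Irreducible F
  cubic-irreducible {F} deg-F@(has-degree lead≢0 _) no-root = F≉0 , F-not-unit , factors
    where
    F≉0 : ¬ F ≈ₚ []
    F≉0 F≈0 = lead≢0 (F≈0 3)
    F-not-unit : ¬ IsUnit F
    F-not-unit (_ , _ , F≈a) = lead≢0 (F≈a 3)
    no-root-of-factor : ∀ g h → F ≈ₚ g *ₚ h → ∀ r → ¬ (eval g r ≡ 0ℚ ⊎ eval h r ≡ 0ℚ)
    no-root-of-factor g h F≈gh r root =
      no-root r (trans (eval-resp-≈ₚ F (g *ₚ h) r F≈gh) (root-of-*ₚ g h r root))
    factors : ∀ g h → F ≈ₚ g *ₚ h → IsUnit g ⊎ IsUnit h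
    factors g h F≈gh with ≈ₚ[]⊎hasDegree g | ≈ₚ[]⊎hasDegree h
    ... | inj₁ g≈0 | _        =
      contradiction (inj₁ (eval-≈ₚ[] g 0ℚ g≈0)) (no-root-of-factor g h F≈gh 0ℚ)
    ... | inj₂ _   | inj₁ h≈0 =
      contradiction (inj₂ (eval-≈ₚ[] h 0ℚ h≈0)) (no-root-of-factor g h F≈gh 0ℚ)
    ... | inj₂ (i , deg-g) | inj₂ (j , deg-h)
      with degree-≤1-factor (hasDegree-unique (hasDegree-*ₚ deg-g deg-h) (hasDegree-resp-≈ₚ F≈gh deg-F))
                            deg-g deg-h
    ... | inj₁ deg-g₀               = inj₁ (hasDegree-0⇒isUnit deg-g₀)
    ... | inj₂ (inj₂ (inj₁ deg-h₀)) = inj₂ (hasDegree-0⇒isUnit deg-h₀)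
    ... | inj₂ (inj₁ deg-g₁)        =
      contradiction (inj₁ (proj₂ (hasDegree-1⇒root deg-g₁))) (no-root-of-factor g h F≈gh _)
    ... | inj₂ (inj₂ (inj₂ deg-h₁)) =
      contradiction (inj₂ (proj₂ (hasDegree-1⇒root deg-h₁))) (no-root-of-factor g h F≈gh _)

module Arithmetic where

  open import Data.Nat.Base
  open import Data.Nat.Properties
  open import Algebra.Properties.CommutativeSemigroup *-commutativeSemigroup
    using (xy∙z≈xz∙y; xy∙z≈yz∙x; interchange)
  open import Data.Nat.Divisibility
  open import Data.Nat.DivMod using (_/_; m/n*n≡m)
  open import Data.Nat.GCD using (gcd; gcd[m,n]∣m; gcd[m,n]∣n; gcd[m,n]≢0)
  open import Data.Nat.Coprimality using (Coprime; coprime-divisor; coprime-/gcd)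
    renaming (sym to coprime-sym)
  open import Data.Nat.Tactic.RingSolver using (solve-∀)
  open import Data.Product.Base using (∃-syntax; _×_; _,_; proj₁; proj₂)
  open import Data.Sum.Base using (inj₁; inj₂)
  open import Relation.Binary.Definitions using (tri<; tri≈; tri>)
  open import Relation.Binary.PropositionalEquality
  open import Relation.Nullary.Negation using (contradiction)
  open ≡-Reasoning

  data EvenOrOdd : ℕ → Set where
    even : ∀ k → EvenOrOdd (2 * k)
    odd  : ∀ k → EvenOrOdd (1 + 2 * k)

  even-or-odd : ∀ n → EvenOrOdd n
  even-or-odd zero    = even 0
  even-or-odd (suc n) with even-or-odd n
  ... | even k = odd k
  ... | odd k  = subst EvenOrOdd (*-suc 2 k) (even (suc k))

  Odd : ℕ → Set
  Odd x = ∃[ i ] x ≡ 1 + 2 * i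

  odd² : ∀ i → (1 + 2 * i) * (1 + 2 * i) ≡ 1 + 2 * (2 * (i * i + i))
  odd² = solve-∀

  odd⇒odd² : ∀ {x} → Odd x → Odd (x * x)
  odd⇒odd² (i , refl) = 2 * (i * i + i) , odd² i

  twice-odd≢square : ∀ s z → 2 * (1 + 2 * s) ≢ z * z
  twice-odd≢square s z eq with even-or-odd z
  ... | odd k  = even≢odd (1 + 2 * s) (2 * (k * k + k)) (trans eq (odd² k))
  ... | even k = even≢odd (k * k) s (sym (*-cancelˡ-≡ (1 + 2 * s) (2 * (k * k)) 2 (trans eq (even² k))))
    where
    even² : ∀ k → 2 * k * (2 * k) ≡ 2 * (2 * (k * k))
    even² = solve-∀

  odd²+odd²≢² : ∀ {x y z} → Odd x → Odd y → x * x + y * y ≢ z * z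
  odd²+odd²≢² {z = z} (i , refl) (j , refl) eq =
    twice-odd≢square (i * i + i + j * j + j) z (trans (sym (odd²+odd² i j)) eq)
    where
    odd²+odd² : ∀ i j → (1 + 2 * i) * (1 + 2 * i) + (1 + 2 * j) * (1 + 2 * j)
                      ≡ 2 * (1 + 2 * (i * i + i + j * j + j))
    odd²+odd² = solve-∀

  square-injective : ∀ {m n} → m * m ≡ n * n → m ≡ n
  square-injective {m} {n} eq with <-cmp m n
  ... | tri< m<n _ _ = contradiction eq (<⇒≢ (*-mono-< m<n m<n))
  ... | tri≈ _ m≡n _ = m≡n
  ... | tri> _ _ n<m = contradiction (sym eq) (<⇒≢ (*-mono-< n<m n<m))

  square-cancel-≤ : ∀ {m n} → m * m ≤ n * n → m ≤ n
  square-cancel-≤ m²≤n² = ≮⇒≥ λ n<m → <⇒≱ (*-mono-< n<m n<m) m²≤n²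

  n≤n*n : ∀ n → n ≤ n * n
  n≤n*n zero      = z≤n
  n≤n*n n@(suc _) = m≤m*n n n

  n*n≡0⇒n≡0 : ∀ {n} → n * n ≡ 0 → n ≡ 0
  n*n≡0⇒n≡0 {n} n*n≡0 with m*n≡0⇒m≡0∨n≡0 n n*n≡0
  ... | inj₁ n≡0 = n≡0
  ... | inj₂ n≡0 = n≡0

  n^2≡n*n : ∀ n → n ^ 2 ≡ n * n
  n^2≡n*n n = cong (n *_) (*-identityʳ n)

  n^3≡n*n*n : ∀ n → n ^ 3 ≡ n * n * n
  n^3≡n*n*n n = unfolded n
    where
    unfolded : ∀ n → n * (n * (n * 1)) ≡ n * n * n
    unfolded = solve-∀

  n^4≡n*n*n*n : ∀ n → n ^ 4 ≡ n * n * n * n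
  n^4≡n*n*n*n n = unfolded n
    where
    unfolded : ∀ n → n * (n * (n * (n * 1))) ≡ n * n * n * n
    unfolded = solve-∀

  n^4≡n²*n² : ∀ n → n ^ 4 ≡ n * n * (n * n)
  n^4≡n²*n² n = unfolded n
    where
    unfolded : ∀ n → n * (n * (n * (n * 1))) ≡ n * n * (n * n)
    unfolded = solve-∀

  ^-distrib-* : ∀ m n k → (m * n) ^ k ≡ m ^ k * n ^ k
  ^-distrib-* m n zero    = refl
  ^-distrib-* m n (suc k) =
    trans (cong (m * n *_) (^-distrib-* m n k)) (interchange m n (m ^ k) (n ^ k))

  coprime-∣ˡ : ∀ {d m n} → d ∣ m → Coprime m n → Coprime d n
  coprime-∣ˡ d∣m m⊥n (c∣d , c∣n) = m⊥n (∣-trans c∣d d∣m , c∣n)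

  coprime-∣ʳ : ∀ {d m n} → d ∣ n → Coprime m n → Coprime m d
  coprime-∣ʳ d∣n m⊥n = coprime-sym (coprime-∣ˡ d∣n (coprime-sym m⊥n))

  coprime-*ʳ : ∀ {m n o} → Coprime m n → Coprime m o → Coprime m (n * o)
  coprime-*ʳ m⊥n m⊥o (c∣m , c∣no) = m⊥o (c∣m , coprime-divisor (coprime-∣ˡ c∣m m⊥n) c∣no)

  coprime-^ʳ : ∀ {m n} k → Coprime m n → Coprime m (n ^ k)
  coprime-^ʳ zero    _   (_ , c∣1) = ∣1⇒≡1 c∣1
  coprime-^ʳ (suc k) m⊥n = coprime-*ʳ m⊥n (coprime-^ʳ k m⊥n)

  coprime-² : ∀ {m n} → Coprime m n → Coprime (m * m) (n * n)
  coprime-² m⊥n = coprime-sym (coprime-*ʳ n⊥m² n⊥m²)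
    where
    n⊥m² = coprime-sym (coprime-*ʳ m⊥n m⊥n)

  coprime-∣⇒≡1 : ∀ {m n} → Coprime m n → m ∣ n → m ≡ 1
  coprime-∣⇒≡1 m⊥n m∣n = m⊥n (∣-refl , m∣n)

  coprime-+-squares : ∀ {m n} → Coprime m n → Coprime m (m * m + n * n)
  coprime-+-squares {m} m⊥n (c∣m , c∣m²+n²) =
    coprime-*ʳ m⊥n m⊥n (c∣m , ∣m+n∣m⇒∣n c∣m²+n² (∣m⇒∣m*n m c∣m))

  IsPower : ℕ → ℕ → Set
  IsPower k x = ∃[ r ] x ≡ r ^ k

  -- x = x′ g with g = gcd x z; the equation forces both g ^ k ∣ x′ and x′ ∣ g ^ k.
  coprime-factor-isPower : ∀ k {x y z} → Coprime x y → x * y ≡ z ^ suc k → IsPower (suc k) x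
  coprime-factor-isPower k {zero}               _   _      = 0 , refl
  coprime-factor-isPower k {x@(suc _)} {y} {z} x⊥y xy≡z^ = g , (begin
    x         ≡⟨ m/n*n≡m g∣x ⟨
    x′ * g    ≡⟨ cong (_* g) (∣-antisym x′∣g^k g^k∣x′) ⟩
    g ^ k * g ≡⟨ *-comm (g ^ k) g ⟩
    g ^ suc k ∎)
    where
    g = gcd x z
    instance
      g≢0 : NonZero g
      g≢0 = ≢-nonZero (gcd[m,n]≢0 x z (inj₁ λ ()))
    g∣x = gcd[m,n]∣m x z
    x′ = x / g
    z′ = z / g
    x′y≡z′^g^ : x′ * y ≡ z′ ^ suc k * g ^ k
    x′y≡z′^g^ = *-cancelʳ-≡ _ _ g (begin
      x′ * y * g               ≡⟨ xy∙z≈xz∙y x′ y g ⟩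
      x′ * g * y               ≡⟨ cong (_* y) (m/n*n≡m g∣x) ⟩
      x * y                    ≡⟨ xy≡z^ ⟩
      z ^ suc k                ≡⟨ cong (_^ suc k) (m/n*n≡m (gcd[m,n]∣n x z)) ⟨
      (z′ * g) ^ suc k         ≡⟨ ^-distrib-* z′ g (suc k) ⟩
      z′ ^ suc k * (g * g ^ k) ≡⟨ cong (z′ ^ suc k *_) (*-comm g (g ^ k)) ⟩
      z′ ^ suc k * (g ^ k * g) ≡⟨ *-assoc (z′ ^ suc k) (g ^ k) g ⟨
      z′ ^ suc k * g ^ k * g   ∎)
    g^k∣x′ : g ^ k ∣ x′
    g^k∣x′ = coprime-divisor (coprime-sym (coprime-^ʳ k (coprime-sym (coprime-∣ˡ g∣x x⊥y))))
               (divides (z′ ^ suc k) (trans (*-comm y x′) x′y≡z′^g^))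
    x′∣g^k : x′ ∣ g ^ k
    x′∣g^k = coprime-divisor (coprime-^ʳ (suc k) (coprime-/gcd x z))
               (divides y (trans (sym x′y≡z′^g^) (*-comm x′ y)))

  coprime-factor-square : ∀ {x y} z → Coprime x y → x * y ≡ z * z → ∃[ r ] x ≡ r * r
  coprime-factor-square z x⊥y xy≡z²
    with coprime-factor-isPower 1 {z = z} x⊥y (trans xy≡z² (sym (n^2≡n*n z)))
  ... | r , x≡r^2 = r , trans x≡r^2 (n^2≡n*n r)

  -- m = m′ g and n = n′ g with g = gcd m n; then n′ ∣ m′ ^ k forces n′ = 1 and m′ ^ k = g.
  ^≡^suc⇒isPower : ∀ k {m} n → m ^ k ≡ n ^ suc k → IsPower (suc k) m
  ^≡^suc⇒isPower k {m} zero        m^k≡0  = 0 , m^n≡0⇒m≡0 m k m^k≡0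
  ^≡^suc⇒isPower k {m} n@(suc _) m^k≡n^ = m′ , (begin
    m          ≡⟨ m/n*n≡m g∣m ⟨
    m′ * g     ≡⟨ cong (m′ *_) m′^k≡g ⟨
    m′ ^ suc k ∎)
    where
    g = gcd m n
    instance
      g≢0 : NonZero g
      g≢0 = ≢-nonZero (gcd[m,n]≢0 m n (inj₂ λ ()))
      g^k≢0 : NonZero (g ^ k)
      g^k≢0 = m^n≢0 g k
    g∣m = gcd[m,n]∣m m n
    m′ = m / g
    n′ = n / g
    m′^k≡n′^g : m′ ^ k ≡ n′ ^ suc k * g
    m′^k≡n′^g = *-cancelʳ-≡ _ _ (g ^ k) (begin
      m′ ^ k * g ^ k           ≡⟨ ^-distrib-* m′ g k ⟨
      (m′ * g) ^ k             ≡⟨ cong (_^ k) (m/n*n≡m g∣m) ⟩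
      m ^ k                    ≡⟨ m^k≡n^ ⟩
      n ^ suc k                ≡⟨ cong (_^ suc k) (m/n*n≡m (gcd[m,n]∣n m n)) ⟨
      (n′ * g) ^ suc k         ≡⟨ ^-distrib-* n′ g (suc k) ⟩
      n′ ^ suc k * (g * g ^ k) ≡⟨ *-assoc (n′ ^ suc k) g (g ^ k) ⟨
      n′ ^ suc k * g * g ^ k   ∎)
    n′≡1 : n′ ≡ 1
    n′≡1 = coprime-∣⇒≡1 (coprime-^ʳ k (coprime-sym (coprime-/gcd m n)))
             (divides (n′ ^ k * g) (trans m′^k≡n′^g (xy∙z≈yz∙x n′ (n′ ^ k) g)))
    m′^k≡g : m′ ^ k ≡ g
    m′^k≡g = begin
      m′ ^ k         ≡⟨ m′^k≡n′^g ⟩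
      n′ ^ suc k * g ≡⟨ cong (λ n′ → n′ ^ suc k * g) n′≡1 ⟩
      1 ^ suc k * g  ≡⟨ cong (_* g) (^-zeroˡ (suc k)) ⟩
      1 * g          ≡⟨ *-identityˡ g ⟩
      g              ∎

  -- The right triangle with legs x and 2 w and hypotenuse x + d.
  pythagorean-even-leg : ∀ {x w d} → Coprime x (2 * w) → 2 * w * (2 * w) ≡ d * (2 * x + d) →
    ∃[ m ] ∃[ n ] Coprime m n × x + n * n ≡ m * m × w ≡ m * n × d ≡ 2 * (n * n)
  pythagorean-even-leg {x} {w} {d} x⊥2w eq with even-or-odd d
  ... | odd j  = contradiction (trans (sym (even² w)) (trans eq (odd*odd x j)))
                   (even≢odd (2 * (w * w)) (x + 2 * j + 2 * (j * (x + j))))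
    where
    even² : ∀ w → 2 * w * (2 * w) ≡ 2 * (2 * (w * w))
    even² = solve-∀
    odd*odd : ∀ x j → (1 + 2 * j) * (2 * x + (1 + 2 * j)) ≡ 1 + 2 * (x + 2 * j + 2 * (j * (x + j)))
    odd*odd = solve-∀
  ... | even q = m , n , m⊥n , x+n²≡m² , w≡mn , cong (2 *_) q≡n²
    where
    4w² : ∀ w → 2 * w * (2 * w) ≡ 4 * (w * w)
    4w² = solve-∀
    4q[x+q] : ∀ x q → 2 * q * (2 * x + 2 * q) ≡ 4 * (q * (x + q))
    4q[x+q] = solve-∀
    w²≡q[x+q] : w * w ≡ q * (x + q)
    w²≡q[x+q] = *-cancelˡ-≡ _ _ 4 (trans (sym (4w² w)) (trans eq (4q[x+q] x q)))
    q⊥x+q : Coprime q (x + q)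
    q⊥x+q {c} (c∣q , c∣x+q) = coprime-*ʳ x⊥2w x⊥2w (c∣x , c∣[2w]²)
      where
      c∣x = ∣m+n∣m⇒∣n (subst (c ∣_) (+-comm x q) c∣x+q) c∣q
      c∣[2w]² = subst (c ∣_) (trans (cong (4 *_) (sym w²≡q[x+q])) (sym (4w² w)))
                  (∣n⇒∣m*n 4 (∣m⇒∣m*n (x + q) c∣q))
    q-square   = coprime-factor-square w q⊥x+q (sym w²≡q[x+q])
    x+q-square = coprime-factor-square w (coprime-sym q⊥x+q) (trans (*-comm (x + q) q) (sym w²≡q[x+q]))
    n = proj₁ q-square
    m = proj₁ x+q-square
    q≡n² : q ≡ n * n
    q≡n² = proj₂ q-square
    x+q≡m² : x + q ≡ m * m
    x+q≡m² = proj₂ x+q-square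
    m⊥n : Coprime m n
    m⊥n = coprime-sym (coprime-∣ʳ (subst (m ∣_) (sym x+q≡m²) (m∣m*n m))
                        (coprime-∣ˡ (subst (n ∣_) (sym q≡n²) (m∣m*n n)) q⊥x+q))
    x+n²≡m² : x + n * n ≡ m * m
    x+n²≡m² = trans (cong (x +_) (sym q≡n²)) x+q≡m²
    w≡mn : w ≡ m * n
    w≡mn = square-injective (begin
      w * w            ≡⟨ w²≡q[x+q] ⟩
      q * (x + q)      ≡⟨ cong₂ _*_ q≡n² x+q≡m² ⟩
      n * n * (m * m)  ≡⟨ *-comm (n * n) (m * m) ⟩
      m * m * (n * n)  ≡⟨ interchange m n m n ⟨
      m * n * (m * n)  ∎)

  record EuclidParameters (x y z : ℕ) : Set where
    field
      m n        : ℕ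
      coprime    : Coprime m n
      odd-leg    : x + n * n ≡ m * m
      even-leg   : y ≡ 2 * (m * n)
      hypotenuse : z ≡ m * m + n * n

  pythagorean : ∀ {x y} z → Odd x → Coprime x y → x * x + y * y ≡ z * z → EuclidParameters x y z
  pythagorean {x} {y} z odd-x x⊥y eq with even-or-odd y
  ... | odd j  = contradiction eq (odd²+odd²≢² {z = z} odd-x (j , refl))
  ... | even w
    with m≤n⇒∃[o]m+o≡n {x} {z} (square-cancel-≤ (≤-trans (m≤m+n (x * x) (y * y)) (≤-reflexive eq)))
  ...   | d , refl
    with pythagorean-even-leg {x} {w} {d} x⊥y (+-cancelˡ-≡ (x * x) _ _ (trans eq (square-+ x d)))
    where
    square-+ : ∀ x d → (x + d) * (x + d) ≡ x * x + d * (2 * x + d)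
    square-+ = solve-∀
  ...     | m , n , m⊥n , x+n²≡m² , w≡mn , d≡2n² = record
    { coprime    = m⊥n
    ; odd-leg    = x+n²≡m²
    ; even-leg   = cong (2 *_) w≡mn
    ; hypotenuse = begin
        x + d              ≡⟨ cong (x +_) d≡2n² ⟩
        x + 2 * (n * n)    ≡⟨ x+2a≡x+a+a x (n * n) ⟩
        x + n * n + n * n  ≡⟨ cong (_+ n * n) x+n²≡m² ⟩
        m * m + n * n      ∎
    }
    where
    x+2a≡x+a+a : ∀ x a → x + 2 * a ≡ x + a + a
    x+2a≡x+a+a = solve-∀

module FermatQuartic where

  open Arithmetic
  open import Data.Nat.Base
  open import Data.Nat.Properties
  open import Data.Nat.Divisibility
  open import Data.Nat.Coprimality using (Coprime; coprime-divisor) renaming (sym to coprime-sym)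
  open import Data.Nat.Induction using (<-rec)
  open import Data.Nat.Tactic.RingSolver using (solve-∀)
  open import Data.Sum.Base using ([_,_]′)
  open import Data.Product.Base using (∃-syntax; _×_; _,_; proj₁; proj₂)
  open import Function.Base using (_∘_)
  open import Relation.Binary.PropositionalEquality
  open import Relation.Nullary.Negation using (¬_; contradiction)

  record QuarticSolution (z : ℕ) : Set where
    constructor quartic-solution
    field
      x y      : ℕ
      coprime  : Coprime x y
      x≢0      : x ≢ 0
      y≢0      : y ≢ 0
      equation : x * x * (x * x) + y * y * (y * y) ≡ z * z

  -- Euclid's parametrisation applied twice: to (x², y², z) and then to (x, n, m).
  quartic-descent : ∀ {x y v z} → Odd x → y ≡ 2 * v → Coprime x y → y ≢ 0 →
                    x * x * (x * x) + y * y * (y * y) ≡ z * z → ∃[ c ] c < z × QuarticSolution c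
  quartic-descent {x} {y} {v} {z} odd-x y≡2v x⊥y y≢0 eq =
    c , c<z , quartic-solution a b a⊥b a≢0 b≢0 a⁴+b⁴≡c²
    where
    module T₁ = EuclidParameters (pythagorean z (odd⇒odd² odd-x) (coprime-² x⊥y) eq)
    open T₁ using (m; n)
    x⊥n : Coprime x n
    x⊥n {d} (d∣x , d∣n) = coprime-*ʳ n⊥m n⊥m (d∣n , d∣m²)
      where
      n⊥m = coprime-sym T₁.coprime
      d∣m² = subst (d ∣_) T₁.odd-leg (∣m∣n⇒∣m+n (∣m⇒∣m*n x d∣x) (∣m⇒∣m*n n d∣n))
    module T₂ = EuclidParameters (pythagorean m odd-x x⊥n T₁.odd-leg)
    open T₂ using () renaming (m to r; n to s)
    r⊥s = T₂.coprime
    r⊥m : Coprime r m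
    r⊥m = subst (Coprime r) (sym T₂.hypotenuse) (coprime-+-squares r⊥s)
    s⊥m : Coprime s m
    s⊥m = subst (Coprime s) (trans (+-comm (s * s) (r * r)) (sym T₂.hypotenuse))
            (coprime-+-squares (coprime-sym r⊥s))
    r⊥sm : Coprime r (s * m)
    r⊥sm = coprime-*ʳ r⊥s r⊥m
    v²≡r[sm] : v * v ≡ r * (s * m)
    v²≡r[sm] = *-cancelˡ-≡ _ _ 4 (begin
      4 * (v * v)              ≡⟨ 4v² v ⟩
      2 * v * (2 * v)          ≡⟨ cong (λ y → y * y) y≡2v ⟨
      y * y                    ≡⟨ T₁.even-leg ⟩
      2 * (m * n)              ≡⟨ cong (λ n → 2 * (m * n)) T₂.even-leg ⟩
      2 * (m * (2 * (r * s)))  ≡⟨ 4rsm m r s ⟩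
      4 * (r * (s * m))        ∎)
      where
      open ≡-Reasoning
      4v² : ∀ v → 4 * (v * v) ≡ 2 * v * (2 * v)
      4v² = solve-∀
      4rsm : ∀ m r s → 2 * (m * (2 * (r * s))) ≡ 4 * (r * (s * m))
      4rsm = solve-∀
    r-square  = coprime-factor-square v r⊥sm (sym v²≡r[sm])
    sm-square = coprime-factor-square v (coprime-sym r⊥sm) (trans (*-comm (s * m) r) (sym v²≡r[sm]))
    t = proj₁ sm-square
    s-square  = coprime-factor-square t s⊥m (proj₂ sm-square)
    m-square  = coprime-factor-square t (coprime-sym s⊥m) (trans (*-comm m s) (proj₂ sm-square))
    a = proj₁ r-square
    b = proj₁ s-square
    c = proj₁ m-square
    r≡a² : r ≡ a * a
    r≡a² = proj₂ r-square
    s≡b² : s ≡ b * b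
    s≡b² = proj₂ s-square
    m≡c² : m ≡ c * c
    m≡c² = proj₂ m-square
    a⁴+b⁴≡c² : a * a * (a * a) + b * b * (b * b) ≡ c * c
    a⁴+b⁴≡c² = begin
      a * a * (a * a) + b * b * (b * b)  ≡⟨ cong₂ (λ r s → r * r + s * s) r≡a² s≡b² ⟨
      r * r + s * s                      ≡⟨ T₂.hypotenuse ⟨
      m                                  ≡⟨ m≡c² ⟩
      c * c                              ∎
      where open ≡-Reasoning
    a⊥b : Coprime a b
    a⊥b = coprime-∣ʳ (subst (b ∣_) (sym s≡b²) (m∣m*n b))
            (coprime-∣ˡ (subst (a ∣_) (sym r≡a²) (m∣m*n a)) r⊥s)
    n≢0 : n ≢ 0
    n≢0 n≡0 = y≢0 (n*n≡0⇒n≡0 (begin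
      y * y        ≡⟨ T₁.even-leg ⟩
      2 * (m * n)  ≡⟨ cong (λ n → 2 * (m * n)) n≡0 ⟩
      2 * (m * 0)  ≡⟨ cong (2 *_) (*-zeroʳ m) ⟩
      0            ∎))
      where open ≡-Reasoning
    n≡2rs = T₂.even-leg
    a≢0 : a ≢ 0
    a≢0 a≡0 = n≢0 (trans n≡2rs (cong (λ r → 2 * (r * s)) (trans r≡a² (cong (λ a → a * a) a≡0))))
    b≢0 : b ≢ 0
    b≢0 b≡0 = n≢0 (trans n≡2rs (trans (cong (λ s → 2 * (r * s)) (trans s≡b² (cong (λ b → b * b) b≡0)))
                                      (cong (2 *_) (*-zeroʳ r))))
    c<z : c < z
    c<z = begin-strict
      c              ≤⟨ n≤n*n c ⟩
      c * c          ≡⟨ m≡c² ⟨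
      m              ≤⟨ n≤n*n m ⟩
      m * m          <⟨ m<m+n (m * m) (n≢0⇒n>0 (n≢0 ∘ n*n≡0⇒n≡0)) ⟩
      m * m + n * n  ≡⟨ T₁.hypotenuse ⟨
      z              ∎
      where open ≤-Reasoning

  smaller-quartic-solution : ∀ {z} → QuarticSolution z → ∃[ c ] c < z × QuarticSolution c
  smaller-quartic-solution {z} (quartic-solution x y x⊥y x≢0 y≢0 eq) with even-or-odd x | even-or-odd y
  ... | even i | even j = contradiction (x⊥y (divides i (*-comm 2 i) , divides j (*-comm 2 j))) λ ()
  ... | odd i  | odd j  = contradiction eq (odd²+odd²≢² {z = z} (odd⇒odd² (i , refl)) (odd⇒odd² (j , refl)))
  ... | odd i  | even j = quartic-descent {v = j} (i , refl) refl x⊥y y≢0 eq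
  ... | even i | odd j  = quartic-descent {v = i} (j , refl) refl (coprime-sym x⊥y) x≢0
                            (trans (+-comm (y * y * (y * y)) (x * x * (x * x))) eq)

  no-quartic-solution : ∀ z → ¬ QuarticSolution z
  no-quartic-solution = <-rec _ λ z rec sol →
    let c , c<z , sol′ = smaller-quartic-solution sol in rec c<z sol′

  coprime-a²+ab+b² : ∀ {a b} → Coprime a b → Coprime a (a * a + a * b + b * b)
  coprime-a²+ab+b² {a} {b} a⊥b (d∣a , d∣W) =
    coprime-*ʳ a⊥b a⊥b (d∣a , ∣m+n∣m⇒∣n d∣W d∣a²+ab)
    where
    d∣a²+ab = ∣m∣n⇒∣m+n (∣m⇒∣m*n a d∣a) (∣m⇒∣m*n b d∣a)

  -- With t = a / b and u = p / q in lowest terms, this is t³ + t² + t ≢ u⁴ for t ≥ 0 and u ≠ 0.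
  a[a²+ab+b²]q⁴≢p⁴b³ : ∀ {a b p q} → Coprime a b → Coprime p q → b ≢ 0 → p ≢ 0 →
                       a * (a * a + a * b + b * b) * q ^ 4 ≢ p ^ 4 * b ^ 3
  a[a²+ab+b²]q⁴≢p⁴b³ {a} {b} {p} {q} a⊥b p⊥q b≢0 p≢0 eq =
    no-quartic-solution (a + b) (quartic-solution s (r * m) s⊥rm s≢0 rm≢0 s⁴+[rm]⁴≡[a+b]²)
    where
    W = a * a + a * b + b * b
    instance
      b≢0′ : NonZero b
      b≢0′ = ≢-nonZero b≢0
    a⊥W : Coprime a W
    a⊥W = coprime-a²+ab+b² a⊥b
    b⊥W : Coprime b W
    b⊥W = subst (Coprime b) (symmetric b a) (coprime-a²+ab+b² (coprime-sym a⊥b))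
      where
      symmetric : ∀ b a → b * b + b * a + a * a ≡ a * a + a * b + b * b
      symmetric = solve-∀
    b³≡q⁴ : b ^ 3 ≡ q ^ 4
    b³≡q⁴ = ∣-antisym
      (coprime-divisor (coprime-sym (coprime-^ʳ 3 (coprime-sym (coprime-*ʳ (coprime-sym a⊥b) b⊥W))))
                       (divides (p ^ 4) eq))
      (coprime-divisor (coprime-^ʳ 4 (coprime-sym (coprime-^ʳ 4 p⊥q))) (divides (a * W) (sym eq)))
    instance
      q⁴≢0 : NonZero (q ^ 4)
      q⁴≢0 = subst NonZero b³≡q⁴ (m^n≢0 b 3)
    aW≡p⁴ : a * W ≡ p ^ 4
    aW≡p⁴ = *-cancelʳ-≡ _ _ (q ^ 4) (trans eq (cong (p ^ 4 *_) b³≡q⁴))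
    a-fourth = coprime-factor-isPower 3 {z = p} a⊥W aW≡p⁴
    W-fourth = coprime-factor-isPower 3 {z = p} (coprime-sym a⊥W) (trans (*-comm W a) aW≡p⁴)
    b-fourth = ^≡^suc⇒isPower 3 q b³≡q⁴
    r = proj₁ a-fourth
    s = proj₁ W-fourth
    m = proj₁ b-fourth
    a≡r⁴ : a ≡ r * r * (r * r)
    a≡r⁴ = trans (proj₂ a-fourth) (n^4≡n²*n² r)
    W≡s⁴ : W ≡ s * s * (s * s)
    W≡s⁴ = trans (proj₂ W-fourth) (n^4≡n²*n² s)
    b≡m⁴ : b ≡ m * m * (m * m)
    b≡m⁴ = trans (proj₂ b-fourth) (n^4≡n²*n² m)
    ab≡[rm]⁴ : a * b ≡ r * m * (r * m) * (r * m * (r * m))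
    ab≡[rm]⁴ = trans (cong₂ _*_ a≡r⁴ b≡m⁴) (regroup r m)
      where
      regroup : ∀ r m → r * r * (r * r) * (m * m * (m * m)) ≡ r * m * (r * m) * (r * m * (r * m))
      regroup = solve-∀
    s⁴+[rm]⁴≡[a+b]² : s * s * (s * s) + r * m * (r * m) * (r * m * (r * m)) ≡ (a + b) * (a + b)
    s⁴+[rm]⁴≡[a+b]² = trans (cong₂ _+_ (sym W≡s⁴) (sym ab≡[rm]⁴)) (square-of-sum a b)
      where
      square-of-sum : ∀ a b → a * a + a * b + b * b + a * b ≡ (a + b) * (a + b)
      square-of-sum = solve-∀
    s⊥rm : Coprime s (r * m)
    s⊥rm {d} (d∣s , d∣rm) =
      coprime-*ʳ (coprime-sym a⊥W) (coprime-sym b⊥W) (∣-fourth W≡s⁴ d∣s , ∣-fourth ab≡[rm]⁴ d∣rm)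
      where
      ∣-fourth : ∀ {n x} → n ≡ x * x * (x * x) → d ∣ x → d ∣ n
      ∣-fourth {x = x} n≡x⁴ d∣x = subst (d ∣_) (sym n≡x⁴) (∣m⇒∣m*n (x * x) (∣m⇒∣m*n x d∣x))
    s≢0 : s ≢ 0
    s≢0 s≡0 =
      b≢0 (n*n≡0⇒n≡0 (m+n≡0⇒n≡0 (a * a + a * b) (trans W≡s⁴ (cong (λ s → s * s * (s * s)) s≡0))))
    rm≢0 : r * m ≢ 0
    rm≢0 rm≡0 = [ r≢0 , m≢0 ]′ (m*n≡0⇒m≡0∨n≡0 r rm≡0)
      where
      r≢0 : r ≢ 0
      r≢0 r≡0 = p≢0 (m^n≡0⇒m≡0 p 4 (trans (sym aW≡p⁴)
                  (cong (_* W) (trans a≡r⁴ (cong (λ r → r * r * (r * r)) r≡0)))))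
      m≢0 : m ≢ 0
      m≢0 m≡0 = b≢0 (trans b≡m⁴ (cong (λ m → m * m * (m * m)) m≡0))

module RationalCurve where

  open Arithmetic
  open FermatQuartic
  open import Data.Nat.Base as ℕ using (suc)
  open import Data.Nat.Coprimality using (Coprime; recompute)
  open import Data.Integer.Base using (+_; +[1+_]; -[1+_]; ∣_∣; _+_; _*_)
  open import Data.Integer.Properties using (+-injective; *-cancelʳ-≡)
  open import Data.Integer.Tactic.RingSolver using (solve-∀)
  open import Data.Rational.Base as ℚ using (ℚ; mkℚ; 0ℚ; ↥_; ↧_; toℚᵘ)
  open import Data.Rational.Properties using (↥p≡0⇒p≡0; toℚᵘ-homo-*; toℚᵘ-homo-+)
  open import Data.Rational.Unnormalised.Base as ℚᵘ using (_≃_)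
  open import Data.Rational.Unnormalised.Properties
    using (≃-refl; ≃-trans; ≃-sym; ≃-reflexive; drop-*≡*; +-cong; *-congʳ)
  open import Relation.Binary.PropositionalEquality

  -- Once X is a constructor, the left side computes to a negative and the right to a positive integer.
  negative-side≢positive : ∀ a b q X r →
    -[1+ a ] * (X * X + + 3 * (+[1+ b ] * +[1+ b ])) * (+[1+ q ] * +[1+ q ] * +[1+ q ] * +[1+ q ])
    ≢ +[1+ r ]
  negative-side≢positive a b q (+ 0)    r ()
  negative-side≢positive a b q +[1+ x ] r ()
  negative-side≢positive a b q -[1+ x ] r ()

  A[A²+AB+B²]Q⁴≢P⁴B³ : ∀ A {b q p} → Coprime ∣ A ∣ (suc b) → Coprime (suc p) (suc q) →
    let B = +[1+ b ]; Q = +[1+ q ]; P = +[1+ p ] in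
    A * (A * A + A * B + B * B) * (Q * Q * Q * Q) ≢ P * P * P * P * (B * B * B)
  A[A²+AB+B²]Q⁴≢P⁴B³ (+ 0)    _   _   ()
  -- For positive A both sides compute to + applied to the corresponding natural numbers.
  A[A²+AB+B²]Q⁴≢P⁴B³ +[1+ a ] {b} {q} {p} a⊥b p⊥q eq =
    a[a²+ab+b²]q⁴≢p⁴b³ a⊥b p⊥q (λ ()) (λ ()) (begin
      a′ ℕ.* W ℕ.* q′ ℕ.^ 4
        ≡⟨ cong (a′ ℕ.* W ℕ.*_) (n^4≡n*n*n*n q′) ⟩
      a′ ℕ.* W ℕ.* (q′ ℕ.* q′ ℕ.* q′ ℕ.* q′)
        ≡⟨ +-injective eq ⟩
      p′ ℕ.* p′ ℕ.* p′ ℕ.* p′ ℕ.* (b′ ℕ.* b′ ℕ.* b′)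
        ≡⟨ cong₂ ℕ._*_ (n^4≡n*n*n*n p′) (n^3≡n*n*n b′) ⟨
      p′ ℕ.^ 4 ℕ.* b′ ℕ.^ 3
        ∎)
    where
    open ≡-Reasoning
    a′ = suc a
    b′ = suc b
    p′ = suc p
    q′ = suc q
    W = a′ ℕ.* a′ ℕ.+ a′ ℕ.* b′ ℕ.+ b′ ℕ.* b′
  A[A²+AB+B²]Q⁴≢P⁴B³ -[1+ a ] {b} {q} _ _ eq =
    negative-side≢positive a b q (+ 2 * A + B) _ (trans (quadrupled A B Q) (cong (+ 4 *_) eq))
    where
    A = -[1+ a ]
    B = +[1+ b ]
    Q = +[1+ q ]
    quadrupled : ∀ A B Q → A * ((+ 2 * A + B) * (+ 2 * A + B) + + 3 * (B * B)) * (Q * Q * Q * Q)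
                         ≡ + 4 * (A * (A * A + A * B + B * B) * (Q * Q * Q * Q))
    quadrupled = solve-∀

  toℚᵘ-t³+t²+t : ∀ t → let T = toℚᵘ t in
    toℚᵘ (t ℚ.* t ℚ.* t ℚ.+ t ℚ.* t ℚ.+ t) ≃ T ℚᵘ.* T ℚᵘ.* T ℚᵘ.+ T ℚᵘ.* T ℚᵘ.+ T
  toℚᵘ-t³+t²+t t = ≃-trans (toℚᵘ-homo-+ (t ℚ.* t ℚ.* t ℚ.+ t ℚ.* t) t)
    (+-cong (≃-trans (toℚᵘ-homo-+ (t ℚ.* t ℚ.* t) (t ℚ.* t)) (+-cong toℚᵘ-t³ (toℚᵘ-homo-* t t)))
            ≃-refl)
    where
    toℚᵘ-t³ : toℚᵘ (t ℚ.* t ℚ.* t) ≃ toℚᵘ t ℚᵘ.* toℚᵘ t ℚᵘ.* toℚᵘ t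
    toℚᵘ-t³ = ≃-trans (toℚᵘ-homo-* (t ℚ.* t) t) (*-congʳ (toℚᵘ-homo-* t t))

  toℚᵘ-u⁴ : ∀ u → let U = toℚᵘ u in
    toℚᵘ (u ℚ.* u ℚ.* u ℚ.* u) ≃ U ℚᵘ.* U ℚᵘ.* U ℚᵘ.* U
  toℚᵘ-u⁴ u = ≃-trans (toℚᵘ-homo-* (u ℚ.* u ℚ.* u) u)
    (*-congʳ (≃-trans (toℚᵘ-homo-* (u ℚ.* u) u) (*-congʳ (toℚᵘ-homo-* u u))))

  clear-denominators : ∀ t u → t ℚ.* t ℚ.* t ℚ.+ t ℚ.* t ℚ.+ t ≡ u ℚ.* u ℚ.* u ℚ.* u →
    let A = ↥ t; B = ↧ t; U = ↥ u; Q = ↧ u in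
    A * (A * A + A * B + B * B) * (Q * Q * Q * Q) ≡ U * U * U * U * (B * B * B)
  clear-denominators t@(mkℚ A b _) u@(mkℚ U q _) eq = *-cancelʳ-≡ _ _ (B * B * B) (begin
    A * (A * A + A * B + B * B) * (Q * Q * Q * Q) * (B * B * B)
      ≡⟨ expand-lhs A B Q ⟩
    ((A * A * A * (B * B) + A * A * (B * B * B)) * B + A * (B * B * B * (B * B))) * (Q * Q * Q * Q)
      ≡⟨ cross-multiplied ⟩
    U * U * U * U * (B * B * B * (B * B) * B)
      ≡⟨ expand-rhs U B ⟩
    U * U * U * U * (B * B * B) * (B * B * B)
      ∎)
    where
    open ≡-Reasoning
    B = +[1+ b ]
    Q = +[1+ q ]
    -- ℚᵘ arithmetic on A / B and U / Q unfolds to exactly these numerators and denominators.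
    cross-multiplied : ((A * A * A * (B * B) + A * A * (B * B * B)) * B + A * (B * B * B * (B * B)))
                         * (Q * Q * Q * Q)
                     ≡ U * U * U * U * (B * B * B * (B * B) * B)
    cross-multiplied = drop-*≡*
      (≃-trans (≃-sym (toℚᵘ-t³+t²+t t)) (≃-trans (≃-reflexive (cong toℚᵘ eq)) (toℚᵘ-u⁴ u)))
    expand-lhs : ∀ A B Q → A * (A * A + A * B + B * B) * (Q * Q * Q * Q) * (B * B * B)
                         ≡ ((A * A * A * (B * B) + A * A * (B * B * B)) * B + A * (B * B * B * (B * B)))
                             * (Q * Q * Q * Q)
    expand-lhs = solve-∀
    expand-rhs : ∀ U B → U * U * U * U * (B * B * B * (B * B) * B) ≡ U * U * U * U * (B * B * B) * (B * B * B)
    expand-rhs = solve-∀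

  t³+t²+t≢u⁴ : ∀ t u → u ≢ 0ℚ → t ℚ.* t ℚ.* t ℚ.+ t ℚ.* t ℚ.+ t ≢ u ℚ.* u ℚ.* u ℚ.* u
  t³+t²+t≢u⁴ t               u@(mkℚ (+ 0)    _ _)   u≢0 _  = u≢0 (↥p≡0⇒p≡0 u refl)
  t³+t²+t≢u⁴ t@(mkℚ A _ A⊥b) u@(mkℚ +[1+ p ] _ p⊥q) _   eq =
    A[A²+AB+B²]Q⁴≢P⁴B³ A (recompute A⊥b) (recompute p⊥q) (clear-denominators t u eq)
  t³+t²+t≢u⁴ t@(mkℚ A _ A⊥b) u@(mkℚ -[1+ p ] _ p⊥q) _   eq =
    A[A²+AB+B²]Q⁴≢P⁴B³ A (recompute A⊥b) (recompute p⊥q) (clear-denominators t u eq)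

open Polynomials
open RationalCurve using (t³+t²+t≢u⁴)
open import Data.Nat.Base using (suc)
open import Data.Integer.Base using (+_)
open import Data.Rational.Base using (ℚ; 0ℚ; 1ℚ; _+_; _-_; _*_; -_; _/_; 1/_; ≢-nonZero)
open import Data.Rational.Properties
  using (+-0-group; *-inverseʳ; *-inverseˡ; *-identityʳ; *-assoc; *-zeroˡ)
open import Algebra.Properties.Group +-0-group using (x∙y⁻¹≈ε⇒x≈y)
open import Data.List.Base using ([]; _∷_)
open import Data.Product.Base using (_×_; _,_)
open import Relation.Binary.PropositionalEquality
open import Relation.Nullary.Negation using (contradiction)
open import Tactic.RingSolver using (solve)

-- The types of coefficientₙ are the normal forms of the n-th coefficients of both sides.
factorisation : ∀ v c → ℚ[ 8 ] * v * c ≡ v * v * v * v + ℚ[ 16 ] →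
                ((ℚ[ 64 ] * v * v) ∷ []) *ₚ P c ≈ₚ F₁ v *ₚ F₂ v
factorisation v c 8vc≡v⁴+16 = λ where
    0 → coefficient₀
    1 → coefficient₁
    2 → coefficient₂
    3 → coefficient₃
    4 → coefficient₄
    5 → coefficient₅
    6 → coefficient₆
    (suc (suc (suc (suc (suc (suc (suc n))))))) → refl
  where
  coefficient₀ : ℚ[ 64 ] * v * v * - (c * c) + 0ℚ
               ≡ (- (v * v * v * v) + - ℚ[ 16 ]) * (v * v * v * v + ℚ[ 16 ]) + 0ℚ
  coefficient₀ = begin
    ℚ[ 64 ] * v * v * - (c * c) + 0ℚ
      ≡⟨ solve (v ∷ c ∷ []) ℚ-ring ⟩
    - (ℚ[ 8 ] * v * c * (ℚ[ 8 ] * v * c)) + 0ℚ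
      ≡⟨ cong (λ e → - (e * e) + 0ℚ) 8vc≡v⁴+16 ⟩
    - ((v * v * v * v + ℚ[ 16 ]) * (v * v * v * v + ℚ[ 16 ])) + 0ℚ
      ≡⟨ solve (v ∷ []) ℚ-ring ⟩
    (- (v * v * v * v) + - ℚ[ 16 ]) * (v * v * v * v + ℚ[ 16 ]) + 0ℚ
      ∎
    where open ≡-Reasoning
  coefficient₁ : ℚ[ 64 ] * v * v * 0ℚ
               ≡ (- (v * v * v * v) + - ℚ[ 16 ]) * (ℚ[ 4 ] * v * v * v)
                 + (ℚ[ 4 ] * v * v * v * (v * v * v * v + ℚ[ 16 ]) + 0ℚ)
  coefficient₁ = solve (v ∷ []) ℚ-ring
  coefficient₂ : ℚ[ 64 ] * v * v * - ℚ[ 4 ]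
               ≡ (- (v * v * v * v) + - ℚ[ 16 ]) * (ℚ[ 8 ] * v * v)
                 + (ℚ[ 4 ] * v * v * v * (ℚ[ 4 ] * v * v * v)
                    + (- (ℚ[ 8 ] * v * v) * (v * v * v * v + ℚ[ 16 ]) + 0ℚ))
  coefficient₂ = solve (v ∷ []) ℚ-ring
  coefficient₃ : ℚ[ 64 ] * v * v * 0ℚ
               ≡ (- (v * v * v * v) + - ℚ[ 16 ]) * (ℚ[ 8 ] * v)
                 + (ℚ[ 4 ] * v * v * v * (ℚ[ 8 ] * v * v)
                    + (- (ℚ[ 8 ] * v * v) * (ℚ[ 4 ] * v * v * v)
                       + (ℚ[ 8 ] * v * (v * v * v * v + ℚ[ 16 ]) + 0ℚ)))
  coefficient₃ = solve (v ∷ []) ℚ-ring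
  coefficient₄ : ℚ[ 64 ] * v * v * 0ℚ
               ≡ ℚ[ 4 ] * v * v * v * (ℚ[ 8 ] * v)
                 + (- (ℚ[ 8 ] * v * v) * (ℚ[ 8 ] * v * v) + ℚ[ 8 ] * v * (ℚ[ 4 ] * v * v * v))
  coefficient₄ = solve (v ∷ []) ℚ-ring
  coefficient₅ : ℚ[ 64 ] * v * v * 0ℚ
               ≡ - (ℚ[ 8 ] * v * v) * (ℚ[ 8 ] * v) + ℚ[ 8 ] * v * (ℚ[ 8 ] * v * v)
  coefficient₅ = solve (v ∷ []) ℚ-ring
  coefficient₆ : ℚ[ 64 ] * v * v * ℚ[ 1 ] ≡ ℚ[ 8 ] * v * (ℚ[ 8 ] * v)
  coefficient₆ = solve (v ∷ []) ℚ-ring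

8v·cOf≡v⁴+16 : ∀ v (v≢0 : v ≢ 0ℚ) → ℚ[ 8 ] * v * cOf v v≢0 ≡ v * v * v * v + ℚ[ 16 ]
8v·cOf≡v⁴+16 v v≢0 = begin
  ℚ[ 8 ] * v * (v⁴+16 * 1/ v * (+ 1 / 8))
    ≡⟨ rearrange v (1/ v) v⁴+16 ⟩
  v⁴+16 * (v * 1/ v) * (ℚ[ 8 ] * (+ 1 / 8))
    ≡⟨ cong (λ e → v⁴+16 * e * (ℚ[ 8 ] * (+ 1 / 8))) (*-inverseʳ v) ⟩
  v⁴+16 * 1ℚ * 1ℚ
    ≡⟨ trans (*-identityʳ (v⁴+16 * 1ℚ)) (*-identityʳ v⁴+16) ⟩
  v⁴+16
    ∎
  where
  open ≡-Reasoning
  instance _ = ≢-nonZero v≢0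
  v⁴+16 = v * v * v * v + ℚ[ 16 ]
  rearrange : ∀ v w X → ℚ[ 8 ] * v * (X * w * (+ 1 / 8)) ≡ X * (v * w) * (ℚ[ 8 ] * (+ 1 / 8))
  rearrange v w X = solve (v ∷ w ∷ X ∷ []) ℚ-ring

F₁-substitution : ∀ v r t u → t * v ≡ ℚ[ 2 ] * r - v → u * v ≡ ℚ[ 2 ] →
  v * v * v * v * (t * t * t + t * t + t - u * u * u * u) ≡ eval (F₁ v) r
F₁-substitution v r t u tv≡2r-v uv≡2 = begin
  v * v * v * v * (t * t * t + t * t + t - u * u * u * u)
    ≡⟨ solve (v ∷ t ∷ u ∷ []) ℚ-ring ⟩
  v * (t * v * (t * v) * (t * v)) + v * v * (t * v * (t * v)) + v * v * v * (t * v)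
    - u * v * (u * v) * (u * v) * (u * v)
    ≡⟨ cong₂ (λ a b → v * (a * a * a) + v * v * (a * a) + v * v * v * a - b * b * b * b) tv≡2r-v uv≡2 ⟩
  v * ((ℚ[ 2 ] * r - v) * (ℚ[ 2 ] * r - v) * (ℚ[ 2 ] * r - v))
    + v * v * ((ℚ[ 2 ] * r - v) * (ℚ[ 2 ] * r - v)) + v * v * v * (ℚ[ 2 ] * r - v)
    - ℚ[ 2 ] * ℚ[ 2 ] * ℚ[ 2 ] * ℚ[ 2 ]
    ≡⟨ solve (v ∷ r ∷ []) ℚ-ring ⟩
  (- (v * v * v * v) + - ℚ[ 16 ])
    + r * (ℚ[ 4 ] * v * v * v + r * (- (ℚ[ 8 ] * v * v) + r * (ℚ[ 8 ] * v + r * 0ℚ)))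
    ∎
  where open ≡-Reasoning

F₁-no-root : ∀ v → v ≢ 0ℚ → ∀ r → eval (F₁ v) r ≢ 0ℚ
F₁-no-root v v≢0 r F₁[r]≡0 =
  t³+t²+t≢u⁴ t u u≢0 (x∙y⁻¹≈ε⇒x≈y (t * t * t + t * t + t) (u * u * u * u) t³+t²+t-u⁴≡0)
  where
  instance _ = ≢-nonZero v≢0
  t = (ℚ[ 2 ] * r - v) * 1/ v
  u = ℚ[ 2 ] * 1/ v
  x/v*v≡x : ∀ x → x * 1/ v * v ≡ x
  x/v*v≡x x = trans (*-assoc x (1/ v) v) (trans (cong (x *_) (*-inverseˡ v)) (*-identityʳ x))
  u≢0 : u ≢ 0ℚ
  u≢0 u≡0 = contradiction (trans (sym (x/v*v≡x ℚ[ 2 ])) (trans (cong (_* v) u≡0) (*-zeroˡ v))) λ ()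
  v⁴≢0 = x*y≢0 (x*y≢0 (x*y≢0 v≢0 v≢0) v≢0) v≢0
  t³+t²+t-u⁴≡0 = x*y≡0⇒y≡0 v⁴≢0
    (trans (F₁-substitution v r t u (x/v*v≡x _) (x/v*v≡x ℚ[ 2 ])) F₁[r]≡0)

F₂-no-root : ∀ v → v ≢ 0ℚ → ∀ r → eval (F₂ v) r ≢ 0ℚ
F₂-no-root v v≢0 r F₂[r]≡0 = F₁-no-root v v≢0 (- r) (begin
  eval (F₁ v) (- r)  ≡⟨ F₁[-x]≡-F₂[x] v r ⟩
  - eval (F₂ v) r    ≡⟨ cong -_ F₂[r]≡0 ⟩
  - 0ℚ               ≡⟨⟩
  0ℚ                 ∎)
  where
  open ≡-Reasoning
  F₁[-x]≡-F₂[x] : ∀ v r →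
    (- (v * v * v * v) + - ℚ[ 16 ])
      + - r * (ℚ[ 4 ] * v * v * v + - r * (- (ℚ[ 8 ] * v * v) + - r * (ℚ[ 8 ] * v + - r * 0ℚ)))
    ≡ - ((v * v * v * v + ℚ[ 16 ])
           + r * (ℚ[ 4 ] * v * v * v + r * (ℚ[ 8 ] * v * v + r * (ℚ[ 8 ] * v + r * 0ℚ))))
  F₁[-x]≡-F₂[x] v r = solve (v ∷ r ∷ []) ℚ-ring

proposition4p6 : (v : ℚ) → (v≢0 : v ≢ 0ℚ) →
    (((ℚ[ 64 ] * v * v) ∷ []) *ₚ P (cOf v v≢0) ≈ₚ F₁ v *ₚ F₂ v)
    × Irreducible (F₁ v) × Irreducible (F₂ v)
proposition4p6 v v≢0 =
  factorisation v (cOf v v≢0) (8v·cOf≡v⁴+16 v v≢0) ,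
  cubic-irreducible (hasDegree-cubic 8v≢0) (F₁-no-root v v≢0) ,
  cubic-irreducible (hasDegree-cubic 8v≢0) (F₂-no-root v v≢0)
  where
  8v≢0 = x*y≢0 {ℚ[ 8 ]} (λ ()) v≢0
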